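{- Let $n\ge 1$ and consider the Ziggu state graph on $n$ digits (defined in the context). The longest solution, i.e. the solution with the most states, has exactly $(3^{n+1}-1)/2$ states and therefore $(3^{n+1}-3)/2$ moves. These quantities equal the number of states, which are the strings $q$ that are states and lie between $0^n$ and $3^n$ in the quaternary reflected Gray code, and the number of moves among them.
   Context: Ziggu state graph on $n$ digits. Write strings over $\{0,1,2,3\}$ as $q=q_nq_{n-1}\cdots q_1$, where $q_1$ is the rightmost digit. A state is such a string in which every digit to the right of a $3$ is also a $3$; that is, for $1\le i<n$, $q_{i+1}=3$ implies $q_i=3$. Two states $q,q'$ are adjacent iff they agree in all positions except one position $i$, where $\{q_i,q'_i\}=\{a,a+1\}$ for some $a\in\{0,1,2\}$, and, if $i\ge2$, the common digit $q_{i-1}$ equals $3$ when $a$ is even and equals $0$ when $a$ is odd. A solution is a sequence of pairwise distinct states from $0^n$ to $3^n$ in which consecutive states are adjacent. Its number of states is the length of the sequence, and its number of moves is one less. The quaternary reflected Gray code $\mathbb{Q}(n)$ is the list defined by $\mathbb{Q}(1)=0,1,2,3$ and, for $n\ge2$, $$\mathbb{Q}(n)=0\cdot\mathbb{Q}(n-1),\ 1\cdot\overleftarrow{\mathbb{Q}(n-1)},\ 2\cdot\mathbb{Q}(n-1),\ 3\cdot\overleftarrow{\mathbb{Q}(n-1)}.$$ Here $d\cdot L$ prefixes the digit $d$ to every string of the list $L$, $\overleftarrow{L}$ is $L$ in reverse order, and commas denote concatenation of lists. -}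

module Defs where

open import Data.Nat using (ℕ; zero; suc; _∸_; _^_; _≤_)
open import Data.Nat.DivMod using (_/_)
open import Data.Fin using (Fin; zero; suc; _≟_)
open import Data.Vec using (Vec; []; _∷_; replicate)
open import Data.Vec.Properties using (≡-dec)
open import Data.List using (List; []; _∷_; _++_; map; reverse; filter; head; last; length)
open import Data.List.Relation.Unary.All as LAll using ()
open import Data.List.Relation.Unary.Unique.Propositional using (Unique)
open import Data.List.Relation.Unary.Linked using (Linked)
open import Data.Vec.Relation.Unary.All as VAll using (all?)
open import Data.Maybe using (just)
open import Data.Product using (Σ; _×_)
open import Data.Sum using (_⊎_)
open import Data.Unit using (⊤; tt)
open import Data.Empty using (⊥)
open import Relation.Binary.PropositionalEquality using (_≡_)
open import Relation.Nullary using (Dec; yes; no)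
open import Relation.Nullary.Decidable using (_×-dec_; _→-dec_)

Digit : Set
Digit = Fin 4

d0 d1 d2 d3 : Digit
d0 = zero
d1 = suc zero
d2 = suc (suc zero)
d3 = suc (suc (suc zero))

-- A string q = q_n q_{n-1} ... q_1 is a vector whose HEAD is q_n
-- (leftmost digit) and whose last entry is q_1 (rightmost digit).
Str : ℕ → Set
Str n = Vec Digit n

IsState : ∀ {n} → Str n → Set
IsState []       = ⊤
IsState (x ∷ xs) = (x ≡ d3 → VAll.All (_≡ d3) xs) × IsState xs

isState? : ∀ {n} (q : Str n) → Dec (IsState q)
isState? []       = yes tt
isState? (x ∷ xs) = ((x ≟ d3) →-dec all? (_≟ d3) xs) ×-dec isState? xs

data Flip : Digit → Digit → Digit → Set where
  f0u : Flip d0 d0 d1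
  f0d : Flip d0 d1 d0
  f1u : Flip d1 d1 d2
  f1d : Flip d1 d2 d1
  f2u : Flip d2 d2 d3
  f2d : Flip d2 d3 d2

required : Digit → Digit
required zero             = d3
required (suc zero)       = d0
required (suc (suc _))    = d3

RightOk : ∀ {m} → Digit → Str m → Set
RightOk a []      = ⊤
RightOk a (z ∷ _) = z ≡ required a

Adj : ∀ {n} → Str n → Str n → Set
Adj []       []       = ⊥
Adj (x ∷ xs) (y ∷ ys) =
  (x ≡ y × Adj xs ys) ⊎ (xs ≡ ys × Σ Digit (λ a → Flip a x y × RightOk a xs))

record IsSolution (n : ℕ) (p : List (Str n)) : Set where
  field
    states   : LAll.All IsState p
    distinct : Unique p
    starts   : head p ≡ just (replicate n d0)
    ends     : last p ≡ just (replicate n d3)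
    steps    : Linked Adj p

numStates : ∀ {n} → List (Str n) → ℕ
numStates p = length p

numMoves : ∀ {n} → List (Str n) → ℕ
numMoves p = length p ∸ 1

-- Quaternary reflected Gray code Q(n) (Q(0) is only an auxiliary base).
Q : (n : ℕ) → List (Str n)
Q zero = [] ∷ []
Q (suc zero) = (d0 ∷ []) ∷ (d1 ∷ []) ∷ (d2 ∷ []) ∷ (d3 ∷ []) ∷ []
Q (suc (suc n)) =
  map (d0 ∷_) (Q (suc n)) ++ map (d1 ∷_) (reverse (Q (suc n))) ++
  map (d2 ∷_) (Q (suc n)) ++ map (d3 ∷_) (reverse (Q (suc n)))

dropBefore : ∀ {n} → Str n → List (Str n) → List (Str n)
dropBefore s [] = []
dropBefore s (x ∷ xs) with ≡-dec _≟_ x s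
... | yes _ = x ∷ xs
... | no  _ = dropBefore s xs

takeThrough : ∀ {n} → Str n → List (Str n) → List (Str n)
takeThrough t [] = []
takeThrough t (x ∷ xs) with ≡-dec _≟_ x t
... | yes _ = x ∷ []
... | no  _ = x ∷ takeThrough t xs

between : ∀ {n} → Str n → Str n → List (Str n) → List (Str n)
between s t L = takeThrough t (dropBefore s L)

grayStates : (n : ℕ) → List (Str n)
grayStates n = filter isState? (between (replicate n d0) (replicate n d3) (Q n))

maxStates : ℕ → ℕ
maxStates n = (3 ^ suc n ∸ 1) / 2

maxMoves : ℕ → ℕ
maxMoves n = (3 ^ suc n ∸ 3) / 2

-- Read in Gray-code order, the states of Q(n+1) are 0·P, 1·reverse P, 2·P and finally 3^{n+1},
-- where P lists the states of Q(n). This list is itself a solution: inside each block it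
-- moves like P, and the junctions 03^n → 13^n, 10^n → 20^n, 23^n → 33^n are legal moves.
-- It contains every state exactly once, so by pigeonhole no solution is longer, and its
-- length ℓ(n) satisfies ℓ(n+1) = 3ℓ(n) + 1, that is 2ℓ(n) + 1 = 3^{n+1}.
module Submission where

open import Defs
open import Data.Nat using (ℕ; _≤_; _∸_)
open import Data.List using (List; length)
open import Data.List.Membership.Propositional using (_∈_)
open import Data.List.Relation.Unary.Unique.Propositional using (Unique)
open import Data.Product using (Σ; _×_)
open import Function.Bundles using (_⇔_)
open import Relation.Binary.PropositionalEquality using (_≡_)

open import Data.Nat using (zero; suc; _+_; _*_; _^_; z≤n; s≤s)
open import Data.Nat.Properties using (+-comm; *-comm; *-distribˡ-∸; module ≤-Reasoning)
open import Data.Nat.DivMod using (_/_; m*n/n≡m)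
open import Data.Nat.Tactic.RingSolver using (solve-∀)
open import Data.Fin using (zero; suc; _≟_)
open import Data.Vec using ([]; _∷_; replicate)
open import Data.Vec.Properties using (≡-dec; ∷-injectiveˡ; ∷-injectiveʳ)
import Data.Vec.Relation.Unary.All as VAll
open import Data.List using ([]; _∷_; [_]; _++_; map; reverse; filter; head; last)
open import Data.List.Properties
  using (filter-++; filter-accept; filter-reject; filter-≐; unfold-reverse; reverse-++;
         length-++; length-map; length-reverse; length-removeAt′; filter-none)
open import Data.List.Relation.Unary.All as All using (All)
open import Data.List.Relation.Unary.AllPairs using ([]; _∷_)
open import Data.List.Relation.Unary.All.Properties using (map⁺; ++⁺)
open import Data.List.Relation.Unary.Any using (here; there; index; _─_)
open import Data.List.Relation.Unary.Any.Properties using (reverse⁺)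
open import Data.List.Membership.Propositional.Properties using (∈-++⁺ˡ; ∈-++⁺ʳ; ∈-++⁻; ∈-map⁺; ∈-map⁻)
open import Data.List.Relation.Binary.Subset.Propositional using (_⊆_)
open import Data.List.Relation.Binary.Disjoint.Propositional using (Disjoint)
open import Data.List.Relation.Binary.Permutation.Propositional using (↭-sym; ↭⇒↭ₛ)
open import Data.List.Relation.Binary.Permutation.Propositional.Properties using (↭-reverse; All-resp-↭)
import Data.List.Relation.Binary.Permutation.Setoid.Properties as Permutationₛ
import Data.List.Relation.Unary.Unique.Propositional.Properties as Unique
open import Data.List.Relation.Unary.Linked using (Linked; [-]; _∷_)
open import Data.Maybe using (just)
open import Data.Product using (_,_; proj₁; proj₂)
open import Data.Sum using (inj₁; inj₂)
open import Data.Unit using (tt)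
open import Data.Bool using (true; false)
open import Function using (_∘_)
open import Function.Bundles using (mk⇔)
open import Relation.Binary using (Rel; DecidableEquality)
open import Relation.Binary.PropositionalEquality using (refl; sym; trans; cong; cong₂; subst; setoid; _≢_; _≗_; module ≡-Reasoning)
open import Relation.Nullary using (yes; no; does; contradiction)
open import Relation.Unary using (Pred; Decidable; _≐_) renaming (_⊆_ to _⊆ₚ_)

module _ {A : Set} where

  filter-map : ∀ {B : Set} {p} {P : Pred B p} (P? : Decidable P) (f : A → B) (xs : List A) →
               filter P? (map f xs) ≡ map f (filter (P? ∘ f) xs)
  filter-map P? f [] = refl
  filter-map P? f (x ∷ xs) with does (P? (f x))
  ... | true  = cong (f x ∷_) (filter-map P? f xs)
  ... | false = filter-map P? f xs

  module _ {p} {P : Pred A p} (P? : Decidable P) where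

    reverse-filter-[_] : ∀ x → reverse (filter P? [ x ]) ≡ filter P? [ x ]
    reverse-filter-[ x ] with does (P? x)
    ... | true  = refl
    ... | false = refl

    filter-reverse : ∀ xs → filter P? (reverse xs) ≡ reverse (filter P? xs)
    filter-reverse [] = refl
    filter-reverse (x ∷ xs) = begin
      filter P? (reverse (x ∷ xs))                ≡⟨ cong (filter P?) (unfold-reverse x xs) ⟩
      filter P? (reverse xs ++ [ x ])             ≡⟨ filter-++ P? (reverse xs) [ x ] ⟩
      filter P? (reverse xs) ++ filter P? [ x ]   ≡⟨ cong₂ _++_ (filter-reverse xs) (sym reverse-filter-[ x ]) ⟩
      reverse (filter P? xs) ++ reverse (filter P? [ x ]) ≡⟨ reverse-++ (filter P? [ x ]) (filter P? xs) ⟨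
      reverse (filter P? [ x ] ++ filter P? xs)   ≡⟨ cong reverse (filter-++ P? [ x ] xs) ⟨
      reverse (filter P? (x ∷ xs))                ∎
      where open ≡-Reasoning

    filter-filter-⊆ : ∀ {q} {Q : Pred A q} (Q? : Decidable Q) → P ⊆ₚ Q →
                      filter P? ∘ filter Q? ≗ filter P?
    filter-filter-⊆ Q? P⊆Q [] = refl
    filter-filter-⊆ Q? P⊆Q (x ∷ xs) with ih ← filter-filter-⊆ Q? P⊆Q xs | Q? x
    ... | no ¬qx = trans ih (sym (filter-reject P? (¬qx ∘ P⊆Q)))
    ... | yes _ with does (P? x)
    ...   | true  = cong (x ∷_) ih
    ...   | false = ih

  filter-≡-unique : (_≟_ : DecidableEquality A) {x : A} {xs : List A} →
                    Unique xs → x ∈ xs → filter (_≟ x) xs ≡ [ x ]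
  filter-≡-unique _≟_ {x} (x∉xs ∷ _) (here refl) =
    trans (filter-accept (_≟ x) refl)
          (cong (x ∷_) (filter-none (_≟ x) (All.map (λ x≢y y≡x → x≢y (sym y≡x)) x∉xs)))
  filter-≡-unique _≟_ (y∉ys ∷ u) (there x∈ys) =
    trans (filter-reject (_≟ _) (λ y≡x → All.lookup y∉ys x∈ys y≡x)) (filter-≡-unique _≟_ u x∈ys)

  Unique-reverse : ∀ {xs : List A} → Unique xs → Unique (reverse xs)
  Unique-reverse {xs} = Permutationₛ.Unique-resp-↭ (setoid A) (↭⇒↭ₛ (↭-sym (↭-reverse xs)))

  All-reverse : ∀ {p} {P : Pred A p} {xs : List A} → All P xs → All P (reverse xs)
  All-reverse {xs = xs} = All-resp-↭ (↭-sym (↭-reverse xs))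

  Disjoint-++⁺ʳ : {xs : List A} (ys : List A) {zs : List A} →
                  Disjoint xs ys → Disjoint xs zs → Disjoint xs (ys ++ zs)
  Disjoint-++⁺ʳ ys xs#ys xs#zs (v∈xs , v∈ys++zs) with ∈-++⁻ ys v∈ys++zs
  ... | inj₁ v∈ys = xs#ys (v∈xs , v∈ys)
  ... | inj₂ v∈zs = xs#zs (v∈xs , v∈zs)

  last-∈ : ∀ {x : A} xs → last xs ≡ just x → x ∈ xs
  last-∈ (y ∷ [])     refl = here refl
  last-∈ (_ ∷ y ∷ ys) eq   = there (last-∈ (y ∷ ys) eq)

  ∈-─⁺ : ∀ {x y : A} {ys} (x∈ys : x ∈ ys) → y ∈ ys → y ≢ x → y ∈ (ys ─ x∈ys)
  ∈-─⁺ (here refl)  (here refl)  y≢x = contradiction refl y≢x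
  ∈-─⁺ (here refl)  (there y∈ys) _   = y∈ys
  ∈-─⁺ (there x∈ys) (here refl)  _   = here refl
  ∈-─⁺ (there x∈ys) (there y∈ys) y≢x = there (∈-─⁺ x∈ys y∈ys y≢x)

  Unique⇒length≤ : {xs ys : List A} → Unique xs → xs ⊆ ys → length xs ≤ length ys
  Unique⇒length≤ {[]}     _            _     = z≤n
  Unique⇒length≤ {x ∷ xs} {ys} (x∉xs ∷ u) xs⊆ys = begin
    suc (length xs)          ≤⟨ s≤s (Unique⇒length≤ u xs⊆ys─x) ⟩
    suc (length (ys ─ x∈ys)) ≡⟨ length-removeAt′ ys (index x∈ys) ⟨
    length ys                ∎
    where
    open ≤-Reasoning
    x∈ys : x ∈ ys
    x∈ys = xs⊆ys (here refl)
    xs⊆ys─x : xs ⊆ (ys ─ x∈ys)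
    xs⊆ys─x y∈xs = ∈-─⁺ x∈ys (xs⊆ys (there y∈xs)) (λ y≡x → All.lookup x∉xs y∈xs (sym y≡x))

data Walk {A : Set} {ℓ} (R : Rel A ℓ) : A → A → List A → Set ℓ where
  stop : ∀ a → Walk R a a [ a ]
  _◅_  : ∀ {a b c xs} → R a b → Walk R b c xs → Walk R a c (a ∷ xs)

infixr 5 _◅_

module _ {A : Set} {ℓ} {R : Rel A ℓ} where

  walk-++ : ∀ {a b c d xs ys} → Walk R a b xs → R b c → Walk R c d ys → Walk R a d (xs ++ ys)
  walk-++ (stop _)  r w = r ◅ w
  walk-++ (r′ ◅ w′) r w = r′ ◅ walk-++ w′ r w

  walk-reverse : (∀ {x y} → R x y → R y x) → ∀ {a b xs} → Walk R a b xs → Walk R b a (reverse xs)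
  walk-reverse R-sym (stop a) = stop a
  walk-reverse R-sym (_◅_ {a} {xs = xs} r w) rewrite unfold-reverse a xs =
    walk-++ (walk-reverse R-sym w) (R-sym r) (stop a)

  walk-map : ∀ {B : Set} {S : Rel B ℓ} (f : A → B) → (∀ {x y} → R x y → S (f x) (f y)) →
             ∀ {a b xs} → Walk R a b xs → Walk S (f a) (f b) (map f xs)
  walk-map f hom (stop a) = stop (f a)
  walk-map f hom (r ◅ w)  = hom r ◅ walk-map f hom w

  walk⇒linked : ∀ {a b xs} → Walk R a b xs → Linked R xs
  walk⇒linked (stop _)     = [-]
  walk⇒linked (r ◅ stop _) = r ∷ [-]
  walk⇒linked (r ◅ r′ ◅ w) = r ∷ walk⇒linked (r′ ◅ w)

  walk-head : ∀ {a b xs} → Walk R a b xs → head xs ≡ just a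
  walk-head (stop _) = refl
  walk-head (_ ◅ _)  = refl

  walk-last : ∀ {a b xs} → Walk R a b xs → last xs ≡ just b
  walk-last (stop _)     = refl
  walk-last (_ ◅ stop _) = refl
  walk-last (_ ◅ r ◅ w)  = walk-last (r ◅ w)

module _ {n : ℕ} {s : Str n} where

  dropBefore-self : ∀ xs → dropBefore s (s ∷ xs) ≡ s ∷ xs
  dropBefore-self xs with ≡-dec _≟_ s s
  ... | yes _   = refl
  ... | no s≢s  = contradiction refl s≢s

  dropBefore-≢ : ∀ {x} xs → x ≢ s → dropBefore s (x ∷ xs) ≡ dropBefore s xs
  dropBefore-≢ {x} xs x≢s with ≡-dec _≟_ x s
  ... | yes x≡s = contradiction x≡s x≢s
  ... | no _    = refl

  takeThrough-self : ∀ xs → takeThrough s (s ∷ xs) ≡ [ s ]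
  takeThrough-self xs with ≡-dec _≟_ s s
  ... | yes _   = refl
  ... | no s≢s  = contradiction refl s≢s

  takeThrough-≢ : ∀ {x} xs → x ≢ s → takeThrough s (x ∷ xs) ≡ x ∷ takeThrough s xs
  takeThrough-≢ {x} xs x≢s with ≡-dec _≟_ x s
  ... | yes x≡s = contradiction x≡s x≢s
  ... | no _    = refl

  dropBefore-head : ∀ {xs} → head xs ≡ just s → dropBefore s xs ≡ xs
  dropBefore-head {_ ∷ xs} refl = dropBefore-self xs

  takeThrough-last : ∀ {xs} → Unique xs → last xs ≡ just s → takeThrough s xs ≡ xs
  takeThrough-last {x ∷ []}     _            _      with ≡-dec _≟_ x s
  ... | yes _ = refl
  ... | no  _ = refl
  takeThrough-last {x ∷ y ∷ ys} (x∉y∷ys ∷ u) last≡s =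
    trans (takeThrough-≢ (y ∷ ys) x≢s) (cong (x ∷_) (takeThrough-last u last≡s))
    where
    x≢s : x ≢ s
    x≢s refl = All.lookup x∉y∷ys (last-∈ (y ∷ ys) last≡s) refl

module _ {n : ℕ} {p} {P : Pred (Str n) p} (P? : Decidable P) where

  filter-dropBefore : ∀ {s} → P s → ∀ xs → filter P? (dropBefore s xs) ≡ dropBefore s (filter P? xs)
  filter-dropBefore ps [] = refl
  filter-dropBefore {s} ps (x ∷ xs) with ≡-dec _≟_ x s
  ... | yes refl rewrite filter-accept P? {xs = xs} ps = sym (dropBefore-self (filter P? xs))
  ... | no x≢s with P? x
  ...   | yes _ = trans (filter-dropBefore ps xs) (sym (dropBefore-≢ (filter P? xs) x≢s))
  ...   | no _  = filter-dropBefore ps xs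

  filter-takeThrough : ∀ {t} → P t → ∀ xs → filter P? (takeThrough t xs) ≡ takeThrough t (filter P? xs)
  filter-takeThrough pt [] = refl
  filter-takeThrough {t} pt (x ∷ xs) with ≡-dec _≟_ x t
  ... | yes refl rewrite filter-accept P? {xs = []} pt | filter-accept P? {xs = xs} pt =
    sym (takeThrough-self (filter P? xs))
  ... | no x≢t with P? x
  ...   | yes _ = trans (cong (x ∷_) (filter-takeThrough pt xs)) (sym (takeThrough-≢ (filter P? xs) x≢t))
  ...   | no _  = filter-takeThrough pt xs

zeros threes : (n : ℕ) → Str n
zeros  n = replicate n d0
threes n = replicate n d3

all-≡⇒replicate : ∀ {n} {c : Digit} {q : Str n} → VAll.All (_≡ c) q → q ≡ replicate n c
all-≡⇒replicate VAll.[]           = refl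
all-≡⇒replicate (refl VAll.∷ q≡c) = cong (_ ∷_) (all-≡⇒replicate q≡c)

replicate-all-≡ : ∀ n (c : Digit) → VAll.All (_≡ c) (replicate n c)
replicate-all-≡ zero    c = VAll.[]
replicate-all-≡ (suc n) c = refl VAll.∷ replicate-all-≡ n c

zeros-state : ∀ n → IsState (zeros n)
zeros-state zero    = tt
zeros-state (suc n) = (λ ()) , zeros-state n

threes-state : ∀ n → IsState (threes n)
threes-state zero    = tt
threes-state (suc n) = (λ _ → replicate-all-≡ n d3) , threes-state n

lead≢3-state : ∀ {n d} → d ≢ d3 → IsState ∘ (d ∷_) ≐ IsState {n}
lead≢3-state d≢3 = proj₂ , λ q-state → (λ d≡3 → contradiction d≡3 d≢3) , q-state

lead3-state : ∀ {n} → IsState ∘ (d3 ∷_) ≐ (_≡ threes n)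
lead3-state {n} = (λ (lead3⇒threes , _) → all-≡⇒replicate (lead3⇒threes refl)) ,
                  λ { refl → threes-state (suc n) }

flip-sym : ∀ {a x y} → Flip a x y → Flip a y x
flip-sym f0u = f0d
flip-sym f0d = f0u
flip-sym f1u = f1d
flip-sym f1d = f1u
flip-sym f2u = f2d
flip-sym f2d = f2u

Adj-sym : ∀ {n} {x y : Str n} → Adj x y → Adj y x
Adj-sym {x = []}    {[]}    ()
Adj-sym {x = _ ∷ _} {_ ∷ _} (inj₁ (refl , x~y))         = inj₁ (refl , Adj-sym x~y)
Adj-sym {x = _ ∷ _} {_ ∷ _} (inj₂ (refl , a , f , ok)) = inj₂ (refl , a , flip-sym f , ok)

Adj-∷ : ∀ {n} (d : Digit) {x y : Str n} → Adj x y → Adj (d ∷ x) (d ∷ y)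
Adj-∷ d x~y = inj₁ (refl , x~y)

rightOk-replicate : ∀ {a} n → RightOk a (replicate n (required a))
rightOk-replicate zero    = tt
rightOk-replicate (suc n) = refl

Adj-flip : ∀ {n a x y} → Flip a x y → Adj (x ∷ replicate n (required a)) (y ∷ replicate n (required a))
Adj-flip {n} f = inj₂ (refl , _ , f , rightOk-replicate n)

module _ {n : ℕ} where

  byLead : (A B C D : List (Str n)) → List (Str (suc n))
  byLead A B C D = map (d0 ∷_) A ++ map (d1 ∷_) B ++ map (d2 ∷_) C ++ map (d3 ∷_) D

  block : Digit → (A B C D : List (Str n)) → List (Str n)
  block zero                   A B C D = A
  block (suc zero)             A B C D = B
  block (suc (suc zero))       A B C D = C
  block (suc (suc (suc zero))) A B C D = D

  byLead-cong : ∀ {A A′ B B′ C C′ D D′ : List (Str n)} → A ≡ A′ → B ≡ B′ → C ≡ C′ → D ≡ D′ →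
                byLead A B C D ≡ byLead A′ B′ C′ D′
  byLead-cong refl refl refl refl = refl

  length-byLead : ∀ A B C D → length (byLead A B C D) ≡ length A + (length B + (length C + length D))
  length-byLead A B C D =
    trans (length-map-++ (d0 ∷_) A) (cong (length A +_)
    (trans (length-map-++ (d1 ∷_) B) (cong (length B +_)
    (trans (length-map-++ (d2 ∷_) C) (cong (length C +_)
    (length-map (d3 ∷_) D))))))
    where
    length-map-++ : ∀ (f : Str n → Str (suc n)) xs {ys} → length (map f xs ++ ys) ≡ length xs + length ys
    length-map-++ f xs {ys} = trans (length-++ (map f xs)) (cong (_+ length ys) (length-map f xs))

  All-byLead : ∀ {p} {P : Pred (Str (suc n)) p} {A B C D : List (Str n)} →
               All (P ∘ (d0 ∷_)) A → All (P ∘ (d1 ∷_)) B → All (P ∘ (d2 ∷_)) C → All (P ∘ (d3 ∷_)) D →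
               All P (byLead A B C D)
  All-byLead a b c d = ++⁺ (map⁺ a) (++⁺ (map⁺ b) (++⁺ (map⁺ c) (map⁺ d)))

  map-∷-disjoint : ∀ {d e : Digit} {xs ys : List (Str n)} → d ≢ e → Disjoint (map (d ∷_) xs) (map (e ∷_) ys)
  map-∷-disjoint d≢e (v∈d∷xs , v∈e∷ys) with ∈-map⁻ _ v∈d∷xs | ∈-map⁻ _ v∈e∷ys
  ... | _ , _ , refl | _ , _ , d∷x≡e∷y = d≢e (∷-injectiveˡ d∷x≡e∷y)

  Unique-byLead : ∀ {A B C D : List (Str n)} → Unique A → Unique B → Unique C → Unique D → Unique (byLead A B C D)
  Unique-byLead {B = B} {C} a b c d =
    Unique.++⁺ (map∷ d0 a)
      (Unique.++⁺ (map∷ d1 b)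
        (Unique.++⁺ (map∷ d2 c) (map∷ d3 d) (map-∷-disjoint λ ()))
        (Disjoint-++⁺ʳ (map (d2 ∷_) C) (map-∷-disjoint λ ()) (map-∷-disjoint λ ())))
      (Disjoint-++⁺ʳ (map (d1 ∷_) B) (map-∷-disjoint λ ())
        (Disjoint-++⁺ʳ (map (d2 ∷_) C) (map-∷-disjoint λ ()) (map-∷-disjoint λ ())))
    where
    map∷ : ∀ (d : Digit) {xs : List (Str n)} → Unique xs → Unique (map (d ∷_) xs)
    map∷ d = Unique.map⁺ ∷-injectiveʳ

  ∈-byLead⁺ : ∀ {A B C D : List (Str n)} d {q} → q ∈ block d A B C D → d ∷ q ∈ byLead A B C D
  ∈-byLead⁺ {A} zero                      q∈A = ∈-++⁺ˡ (∈-map⁺ (d0 ∷_) q∈A)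
  ∈-byLead⁺ {A} {B} (suc zero)            q∈B = ∈-++⁺ʳ (map (d0 ∷_) A) (∈-++⁺ˡ (∈-map⁺ (d1 ∷_) q∈B))
  ∈-byLead⁺ {A} {B} {C} (suc (suc zero))  q∈C =
    ∈-++⁺ʳ (map (d0 ∷_) A) (∈-++⁺ʳ (map (d1 ∷_) B) (∈-++⁺ˡ (∈-map⁺ (d2 ∷_) q∈C)))
  ∈-byLead⁺ {A} {B} {C} (suc (suc (suc zero))) q∈D =
    ∈-++⁺ʳ (map (d0 ∷_) A) (∈-++⁺ʳ (map (d1 ∷_) B) (∈-++⁺ʳ (map (d2 ∷_) C) (∈-map⁺ (d3 ∷_) q∈D)))

  filter-byLead : ∀ {p} {P : Pred (Str (suc n)) p} (P? : Decidable P) A B C D →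
                  filter P? (byLead A B C D) ≡
                  byLead (filter (P? ∘ (d0 ∷_)) A) (filter (P? ∘ (d1 ∷_)) B)
                         (filter (P? ∘ (d2 ∷_)) C) (filter (P? ∘ (d3 ∷_)) D)
  filter-byLead P? A B C D =
    trans (filter-map-++ (d0 ∷_) A) (cong (map (d0 ∷_) (filter (P? ∘ (d0 ∷_)) A) ++_)
    (trans (filter-map-++ (d1 ∷_) B) (cong (map (d1 ∷_) (filter (P? ∘ (d1 ∷_)) B) ++_)
    (trans (filter-map-++ (d2 ∷_) C) (cong (map (d2 ∷_) (filter (P? ∘ (d2 ∷_)) C) ++_)
    (filter-map P? (d3 ∷_) D))))))
    where
    filter-map-++ : ∀ (f : Str n → Str (suc n)) xs {ys} →
                    filter P? (map f xs ++ ys) ≡ map f (filter (P? ∘ f) xs) ++ filter P? ys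
    filter-map-++ f xs {ys} = trans (filter-++ P? (map f xs) ys) (cong (_++ filter P? ys) (filter-map P? f xs))

grayPath : (n : ℕ) → List (Str n)
grayPath zero    = [ [] ]
grayPath (suc n) = byLead (grayPath n) (reverse (grayPath n)) (grayPath n) [ threes n ]

grayPath-walk : ∀ n → Walk Adj (zeros n) (threes n) (grayPath n)
grayPath-walk zero    = stop []
grayPath-walk (suc n) =
  walk-++ (walk-map (d0 ∷_) (Adj-∷ d0) (grayPath-walk n)) (Adj-flip f0u)
  (walk-++ (walk-map (d1 ∷_) (Adj-∷ d1) (walk-reverse Adj-sym (grayPath-walk n))) (Adj-flip f1u)
  (walk-++ (walk-map (d2 ∷_) (Adj-∷ d2) (grayPath-walk n)) (Adj-flip f2u)
  (stop (threes (suc n)))))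

grayPath-states : ∀ n → All IsState (grayPath n)
grayPath-states zero    = tt All.∷ All.[]
grayPath-states (suc n) =
  All-byLead (All.map (prefix d0 λ ()) (grayPath-states n))
             (All.map (prefix d1 λ ()) (All-reverse (grayPath-states n)))
             (All.map (prefix d2 λ ()) (grayPath-states n))
             (threes-state (suc n) All.∷ All.[])
  where
  prefix : ∀ d → d ≢ d3 → IsState {n} ⊆ₚ IsState ∘ (d ∷_)
  prefix d d≢3 = proj₂ (lead≢3-state d≢3)

grayPath-unique : ∀ n → Unique (grayPath n)
grayPath-unique zero    = All.[] ∷ []
grayPath-unique (suc n) =
  Unique-byLead (grayPath-unique n) (Unique-reverse (grayPath-unique n)) (grayPath-unique n) (All.[] ∷ [])

state∈grayPath : ∀ n {q : Str n} → IsState q → q ∈ grayPath n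
state∈grayPath zero    {[]}    _     = here refl
state∈grayPath (suc n) {d ∷ q} state = ∈-byLead⁺ {A = P} {reverse P} {P} {[ threes n ]} d (tail∈block d state)
  where
  P : List (Str n)
  P = grayPath n
  tail∈block : ∀ d → IsState (d ∷ q) → q ∈ block d P (reverse P) P [ threes n ]
  tail∈block zero                   (_ , q-state) = state∈grayPath n q-state
  tail∈block (suc zero)             (_ , q-state) = reverse⁺ (state∈grayPath n q-state)
  tail∈block (suc (suc zero))       (_ , q-state) = state∈grayPath n q-state
  tail∈block (suc (suc (suc zero))) state         = here (proj₁ lead3-state state)

grayPath-solution : ∀ n → IsSolution n (grayPath n)
grayPath-solution n = record
  { states   = grayPath-states n
  ; distinct = grayPath-unique n
  ; starts   = walk-head (grayPath-walk n)
  ; ends     = walk-last (grayPath-walk n)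
  ; steps    = walk⇒linked (grayPath-walk n)
  }

solution-length≤ : ∀ {n p} → IsSolution n p → length p ≤ length (grayPath n)
solution-length≤ {n} sol = Unique⇒length≤ distinct (state∈grayPath n ∘ All.lookup states)
  where open IsSolution sol

_≟ₛ_ : ∀ {n} → DecidableEquality (Str n)
_≟ₛ_ = ≡-dec _≟_

filter-lead3 : ∀ {n} (L : List (Str n)) {M} → filter isState? L ≡ M → Unique M → threes n ∈ M →
               filter (isState? ∘ (d3 ∷_)) L ≡ [ threes n ]
filter-lead3 {n} L refl unique threes∈ = begin
  filter (isState? ∘ (d3 ∷_)) L             ≡⟨ filter-≐ (isState? ∘ (d3 ∷_)) (_≟ₛ threes n) lead3-state L ⟩
  filter (_≟ₛ threes n) L                   ≡⟨ filter-filter-⊆ (_≟ₛ threes n) isState? (λ { refl → threes-state n }) L ⟨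
  filter (_≟ₛ threes n) (filter isState? L) ≡⟨ filter-≡-unique _≟ₛ_ unique threes∈ ⟩
  [ threes n ]                              ∎
  where open ≡-Reasoning

Q-suc : ∀ n → Q (suc n) ≡ byLead (Q n) (reverse (Q n)) (Q n) (reverse (Q n))
Q-suc zero    = refl
Q-suc (suc n) = refl

filter-Q : ∀ n → filter isState? (Q n) ≡ grayPath n
filter-Q zero    = refl
filter-Q (suc n) = begin
  filter isState? (Q (suc n))
    ≡⟨ cong (filter isState?) (Q-suc n) ⟩
  filter isState? (byLead Qₙ (reverse Qₙ) Qₙ (reverse Qₙ))
    ≡⟨ filter-byLead isState? Qₙ (reverse Qₙ) Qₙ (reverse Qₙ) ⟩
  byLead (filter (isState? ∘ (d0 ∷_)) Qₙ) (filter (isState? ∘ (d1 ∷_)) (reverse Qₙ))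
         (filter (isState? ∘ (d2 ∷_)) Qₙ) (filter (isState? ∘ (d3 ∷_)) (reverse Qₙ))
    ≡⟨ byLead-cong (trans (filter-lead≢3 d0 (λ ()) Qₙ) (filter-Q n))
                   (trans (filter-lead≢3 d1 (λ ()) (reverse Qₙ)) reversed)
                   (trans (filter-lead≢3 d2 (λ ()) Qₙ) (filter-Q n))
                   (filter-lead3 (reverse Qₙ) reversed (Unique-reverse (grayPath-unique n))
                                 (reverse⁺ (state∈grayPath n (threes-state n)))) ⟩
  grayPath (suc n) ∎
  where
  open ≡-Reasoning
  Qₙ : List (Str n)
  Qₙ = Q n
  filter-lead≢3 : ∀ d → d ≢ d3 → ∀ xs → filter (isState? ∘ (d ∷_)) xs ≡ filter isState? xs
  filter-lead≢3 d d≢3 = filter-≐ (isState? ∘ (d ∷_)) isState? (lead≢3-state {n} d≢3)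
  reversed : filter isState? (reverse Qₙ) ≡ reverse (grayPath n)
  reversed = trans (filter-reverse isState? Qₙ) (cong reverse (filter-Q n))

grayStates≡grayPath : ∀ n → grayStates n ≡ grayPath n
grayStates≡grayPath n = begin
  filter isState? (takeThrough (threes n) (dropBefore (zeros n) (Q n)))
    ≡⟨ filter-takeThrough isState? (threes-state n) (dropBefore (zeros n) (Q n)) ⟩
  takeThrough (threes n) (filter isState? (dropBefore (zeros n) (Q n)))
    ≡⟨ cong (takeThrough (threes n)) (filter-dropBefore isState? (zeros-state n) (Q n)) ⟩
  takeThrough (threes n) (dropBefore (zeros n) (filter isState? (Q n)))
    ≡⟨ cong (takeThrough (threes n) ∘ dropBefore (zeros n)) (filter-Q n) ⟩
  takeThrough (threes n) (dropBefore (zeros n) (grayPath n))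
    ≡⟨ cong (takeThrough (threes n)) (dropBefore-head (walk-head (grayPath-walk n))) ⟩
  takeThrough (threes n) (grayPath n)
    ≡⟨ takeThrough-last (grayPath-unique n) (walk-last (grayPath-walk n)) ⟩
  grayPath n ∎
  where open ≡-Reasoning

2[3ℓ+1]+1≡3[2ℓ+1] : ∀ ℓ → 2 * (ℓ + (ℓ + (ℓ + 1))) + 1 ≡ 3 * (2 * ℓ + 1)
2[3ℓ+1]+1≡3[2ℓ+1] = solve-∀

length-grayPath : ∀ n → 2 * length (grayPath n) + 1 ≡ 3 ^ suc n
length-grayPath zero    = refl
length-grayPath (suc n) = begin
  2 * length (grayPath (suc n)) + 1
    ≡⟨ cong (λ m → 2 * m + 1) (length-byLead P (reverse P) P [ threes n ]) ⟩
  2 * (ℓ + (length (reverse P) + (ℓ + 1))) + 1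
    ≡⟨ cong (λ m → 2 * (ℓ + (m + (ℓ + 1))) + 1) (length-reverse P) ⟩
  2 * (ℓ + (ℓ + (ℓ + 1))) + 1
    ≡⟨ 2[3ℓ+1]+1≡3[2ℓ+1] ℓ ⟩
  3 * (2 * ℓ + 1)
    ≡⟨ cong (3 *_) (length-grayPath n) ⟩
  3 ^ suc (suc n) ∎
  where
  open ≡-Reasoning
  P : List (Str n)
  P = grayPath n
  ℓ : ℕ
  ℓ = length P

[2ℓ+1∸[2k+1]]/2≡ℓ∸k : ∀ ℓ k → (2 * ℓ + 1 ∸ (2 * k + 1)) / 2 ≡ ℓ ∸ k
[2ℓ+1∸[2k+1]]/2≡ℓ∸k ℓ k = begin
  (2 * ℓ + 1 ∸ (2 * k + 1)) / 2 ≡⟨ cong (_/ 2) (cong₂ _∸_ (+-comm (2 * ℓ) 1) (+-comm (2 * k) 1)) ⟩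
  (2 * ℓ ∸ 2 * k) / 2          ≡⟨ cong (_/ 2) (*-distribˡ-∸ 2 ℓ k) ⟨
  2 * (ℓ ∸ k) / 2              ≡⟨ cong (_/ 2) (*-comm 2 (ℓ ∸ k)) ⟩
  (ℓ ∸ k) * 2 / 2              ≡⟨ m*n/n≡m (ℓ ∸ k) 2 ⟩
  ℓ ∸ k                        ∎
  where open ≡-Reasoning

numStates-grayPath : ∀ n → numStates (grayPath n) ≡ maxStates n
numStates-grayPath n =
  trans (sym ([2ℓ+1∸[2k+1]]/2≡ℓ∸k (length (grayPath n)) 0)) (cong (λ m → (m ∸ 1) / 2) (length-grayPath n))

numMoves-grayPath : ∀ n → numMoves (grayPath n) ≡ maxMoves n
numMoves-grayPath n =
  trans (sym ([2ℓ+1∸[2k+1]]/2≡ℓ∸k (length (grayPath n)) 1)) (cong (λ m → (m ∸ 3) / 2) (length-grayPath n))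

theorem4p4 : (n : ℕ) → 1 ≤ n →
    (Σ (List (Str n)) (λ p → IsSolution n p × numStates p ≡ maxStates n × numMoves p ≡ maxMoves n))
    × (∀ (p : List (Str n)) → IsSolution n p → numStates p ≤ maxStates n)
    × (Σ (List (Str n)) (λ L → Unique L × (∀ q → (q ∈ L) ⇔ IsState q) × length L ≡ maxStates n))
    × (length (grayStates n) ≡ maxStates n × length (grayStates n) ∸ 1 ≡ maxMoves n)
theorem4p4 n _ =
  (grayPath n , grayPath-solution n , numStates-grayPath n , numMoves-grayPath n) ,
  (λ p sol → subst (numStates p ≤_) (numStates-grayPath n) (solution-length≤ sol)) ,
  (grayPath n , grayPath-unique n , grayPath-enumerates , numStates-grayPath n) ,
  subst (λ L → numStates L ≡ maxStates n × numMoves L ≡ maxMoves n) (sym (grayStates≡grayPath n))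
        (numStates-grayPath n , numMoves-grayPath n)
  where
  grayPath-enumerates : ∀ q → q ∈ grayPath n ⇔ IsState q
  grayPath-enumerates q = mk⇔ (All.lookup (grayPath-states n)) (state∈grayPath n)
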